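{- Let $G=(V,E)$ be a finite, undirected, connected, unweighted, simple graph, and let $u,v\in V$. Then $u$ is $v$-far if and only if $u$ is a leaf of every shortest path tree of $G$ rooted at $v$.
   Context: $\mathrm{d}(a,b)$ denotes the shortest-path distance in $G$. A vertex $u$ is called $v$-far if for every neighbor $w$ of $u$ we have $\mathrm{d}(v,w)\le \mathrm{d}(v,u)$. A shortest path tree rooted at $v$ is a spanning tree $T$ of $G$, rooted at $v$, such that the distance in $T$ from $v$ to every vertex $a$ equals $\mathrm{d}(v,a)$. A leaf of such a rooted tree is a vertex with no children. -}

module Defs where

open import Data.Nat using (ℕ; zero; suc; _≤_)
open import Data.Fin using (Fin)
open import Data.Bool using (Bool; true; false)
open import Data.List using (List; []; _∷_)
open import Data.List.Relation.Unary.Unique.Propositional using (Unique)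
open import Data.Product using (Σ; _×_; ∃; ∃-syntax)
open import Relation.Binary.PropositionalEquality using (_≡_)
open import Relation.Nullary using (¬_)

Adjacency : ℕ → Set
Adjacency n = Fin n → Fin n → Bool

record Graph (n : ℕ) : Set where
  field
    adj        : Adjacency n
    adj-sym    : ∀ a b → adj a b ≡ adj b a
    adj-irrefl : ∀ a → adj a a ≡ false
open Graph public

data Walk {n : ℕ} (A : Adjacency n) : Fin n → Fin n → Set where
  nil  : ∀ {a} → Walk A a a
  cons : ∀ {a b c} → A a b ≡ true → Walk A b c → Walk A a c

len : ∀ {n} {A : Adjacency n} {a b} → Walk A a b → ℕ
len nil        = 0
len (cons _ w) = suc (len w)

verts : ∀ {n} {A : Adjacency n} {a b} → Walk A a b → List (Fin n)
verts {a = a} nil        = a ∷ []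
verts {a = a} (cons _ w) = a ∷ verts w

IsPath : ∀ {n} {A : Adjacency n} {a b} → Walk A a b → Set
IsPath w = Unique (verts w)

Connected : ∀ {n} → Adjacency n → Set
Connected A = ∀ a b → Walk A a b

IsDist : ∀ {n} → Adjacency n → Fin n → Fin n → ℕ → Set
IsDist A a b k = Σ (Walk A a b) (λ w → len w ≡ k) × (∀ (w : Walk A a b) → k ≤ len w)

IsTree : ∀ {n} → Adjacency n → Set
IsTree A = Connected A ×
  (∀ a b (p q : Walk A a b) → IsPath p → IsPath q → verts p ≡ verts q)

record SpanningTree {n : ℕ} (G : Graph n) : Set where
  field
    tadj     : Adjacency n
    tadj-sym : ∀ a b → tadj a b ≡ tadj b a
    tadj-sub : ∀ a b → tadj a b ≡ true → adj G a b ≡ true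
    is-tree  : IsTree tadj
open SpanningTree public

IsShortestPathTree : ∀ {n} (G : Graph n) → SpanningTree G → Fin n → Set
IsShortestPathTree G T v = ∀ a k → IsDist (adj G) v a k → IsDist (tadj T) v a k

IsChild : ∀ {n} {G : Graph n} → SpanningTree G → Fin n → Fin n → Fin n → Set
IsChild T v x y =
  tadj T x y ≡ true × ∃[ k ] (IsDist (tadj T) v x k × IsDist (tadj T) v y (suc k))

IsLeaf : ∀ {n} {G : Graph n} → SpanningTree G → Fin n → Fin n → Set
IsLeaf T v x = ∀ y → ¬ IsChild T v x y

IsFar : ∀ {n} → Graph n → Fin n → Fin n → Set
IsFar G v u = ∀ w → adj G u w ≡ true →
  ∀ kw ku → IsDist (adj G) v w kw → IsDist (adj G) v u ku → kw ≤ ku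

-- If u is v-far, a child y of u in a shortest path tree would satisfy
-- d(v,y) = d(v,u) + 1 while being a neighbour of u, so u is a leaf.
-- Conversely, if u has a neighbour w with d(v,w) > d(v,u), then
-- d(v,w) = d(v,u) + 1, and choosing for every vertex a ≠ v a neighbour one
-- level closer to v as its parent (taking u for w) yields a shortest path
-- tree in which w is a child of u.
module Submission where

open import Defs
open import Data.Nat using (ℕ; zero; suc; _≤_; _<_; _≟_; _≤?_)
open import Data.Nat.Properties
  using (≤-refl; ≤-trans; ≤-antisym; ≤-reflexive; ≤-pred; ≤-<-trans; <-irrefl; n≤1+n; n≮n; ≮⇒≥; ≰⇒>;
         suc-injective; anyUpTo?)
open import Data.Nat.Induction using (<-wellFounded)
open import Induction.WellFounded using (Acc; acc)
open import Data.Fin using (Fin) renaming (_≟_ to _≟ᶠ_)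
open import Data.Fin.Properties using (any?)
open import Data.Bool using (true; _∨_)
open import Data.Bool.Properties using (T-≡; T-∨; ∨-comm) renaming (_≟_ to _≟ᵇ_)
open import Data.List using (_∷_)
open import Data.List.Relation.Unary.All using (All; _∷_)
open import Data.List.Relation.Unary.AllPairs using (_∷_)
open import Data.Product using (Σ; _×_; ∃-syntax; _,_; proj₁; proj₂)
open import Data.Sum using (_⊎_; inj₁; inj₂) renaming (map to ⊎-map)
open import Data.Empty using (⊥; ⊥-elim)
open import Data.Vec.Functional using (updateAt)
open import Data.Vec.Functional.Properties using (updateAt-updates; updateAt-minimal)
open import Function using (const)
open import Function.Bundles using (_⇔_; mk⇔; Equivalence)
open import Function.Construct.Identity using (⇔-id)
open import Function.Construct.Composition using (_⇔-∘_)
open import Relation.Binary.PropositionalEquality using (_≡_; _≢_; refl; sym; trans; cong; subst)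
open import Relation.Nullary using (Dec; yes; no)
open import Relation.Nullary.Decidable using (⌊_⌋; map′; toWitness; fromWitness; _×-dec_)

module _ {n : ℕ} {A : Adjacency n} where

  _++ʷ_ : ∀ {a b c} → Walk A a b → Walk A b c → Walk A a c
  nil      ++ʷ w′ = w′
  cons e w ++ʷ w′ = cons e (w ++ʷ w′)

  snoc : ∀ {a b c} → Walk A a b → A b c ≡ true → Walk A a c
  snoc nil        e = cons e nil
  snoc (cons f w) e = cons f (snoc w e)

  len-snoc : ∀ {a b c} (w : Walk A a b) (e : A b c ≡ true) → len (snoc w e) ≡ suc (len w)
  len-snoc nil        e = refl
  len-snoc (cons f w) e = cong suc (len-snoc w e)

  reverse : (∀ a b → A a b ≡ A b a) → ∀ {a b} → Walk A a b → Walk A b a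
  reverse A-sym nil                = nil
  reverse A-sym (cons {a} {b} e w) = snoc (reverse A-sym w) (trans (A-sym b a) e)

  unsnoc : ∀ {a b k} (w : Walk A a b) → len w ≡ suc k →
           ∃[ c ] Σ (Walk A a c) (λ w′ → len w′ ≡ k) × A c b ≡ true
  unsnoc (cons e nil) refl = _ , (nil , refl) , e
  unsnoc {k = zero}  (cons _ (cons _ _)) ()
  unsnoc {k = suc k} (cons e (cons f w)) l with unsnoc (cons f w) (suc-injective l)
  ... | c , (w′ , l′) , g = c , (cons e w′ , cong suc l′) , g

  All-verts-head : ∀ {P : Fin n → Set} {a b} (w : Walk A a b) → All P (verts w) → P a
  All-verts-head nil        (pa ∷ _) = pa
  All-verts-head (cons _ _) (pa ∷ _) = pa

  All-verts-last : ∀ {P : Fin n → Set} {a b} (w : Walk A a b) → All P (verts w) → P b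
  All-verts-last nil        (pb ∷ _)   = pb
  All-verts-last (cons _ w) (_ ∷ all) = All-verts-last w all

  walkOfLength? : (∀ a b → Dec (A a b ≡ true)) → ∀ k a b → Dec (Σ (Walk A a b) λ w → len w ≡ k)
  walkOfLength? A? zero a b =
    map′ (λ { refl → nil , refl }) (λ { (nil , _) → refl ; (cons _ _ , ()) }) (a ≟ᶠ b)
  walkOfLength? A? (suc k) a b =
    map′ (λ (c , e , w , l) → cons e w , cong suc l)
         (λ { (cons e w , l) → _ , e , w , suc-injective l ; (nil , ()) })
         (any? λ c → A? a c ×-dec walkOfLength? A? k c b)

Walk-map : ∀ {n} {A B : Adjacency n} → (∀ a b → A a b ≡ true → B a b ≡ true) →
           ∀ {a b} → Walk A a b → Walk B a b
Walk-map A⊆B nil                = nil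
Walk-map A⊆B (cons {a} {b} e w) = cons (A⊆B a b e) (Walk-map A⊆B w)

len-Walk-map : ∀ {n} {A B : Adjacency n} (A⊆B : ∀ a b → A a b ≡ true → B a b ≡ true) →
               ∀ {a b} (w : Walk A a b) → len (Walk-map A⊆B w) ≡ len w
len-Walk-map A⊆B nil        = refl
len-Walk-map A⊆B (cons e w) = cong suc (len-Walk-map A⊆B w)

minimal : ∀ {P : ℕ → Set} → (∀ k → Dec (P k)) → ∀ {m} → P m →
          ∃[ k ] P k × (∀ {j} → P j → k ≤ j)
minimal {P} P? {m} = go (<-wellFounded m)
  where
  go : ∀ {m} → Acc _<_ m → P m → ∃[ k ] P k × (∀ {j} → P j → k ≤ j)
  go {m} (acc smaller) pm with anyUpTo? P? m
  ... | yes (j , j<m , pj) = go (smaller j<m) pj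
  ... | no none            = m , pm , λ pj → ≮⇒≥ (λ j<m → none (_ , j<m , pj))

module _ {n : ℕ} {A : Adjacency n} where

  IsDist-unique : ∀ {a b k k′} → IsDist A a b k → IsDist A a b k′ → k ≡ k′
  IsDist-unique ((w , refl) , min) ((w′ , refl) , min′) = ≤-antisym (min w′) (min′ w)

  IsDist-zero : ∀ {a b} → IsDist A a b 0 → a ≡ b
  IsDist-zero ((nil , _) , _) = refl

  IsDist-edge : ∀ {v c a kc ka} → IsDist A v c kc → IsDist A v a ka → A c a ≡ true → ka ≤ suc kc
  IsDist-edge ((w , refl) , _) (_ , min) e = subst (_ ≤_) (len-snoc w e) (min (snoc w e))

  IsDist-lastStep : ∀ {v a k} → IsDist A v a (suc k) → ∃[ c ] A c a ≡ true × IsDist A v c k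
  IsDist-lastStep ((w , l) , min) with unsnoc w l
  ... | c , walk , e = c , e , walk , λ w′ → ≤-pred (subst (_ ≤_) (len-snoc w′ e) (min (snoc w′ e)))

  IsDist-exists : (∀ a b → Dec (A a b ≡ true)) → Connected A → ∀ a b → ∃[ k ] IsDist A a b k
  IsDist-exists A? conn a b with minimal (λ k → walkOfLength? A? k a b) (conn a b , refl)
  ... | k , walk , shortest = k , walk , λ w → shortest (w , refl)

  IsDist-subgraph : ∀ {B : Adjacency n} (B⊆A : ∀ a b → B a b ≡ true → A a b ≡ true) →
                    ∀ {a b k} → IsDist A a b k → Σ (Walk B a b) (λ w → len w ≡ k) → IsDist B a b k
  IsDist-subgraph B⊆A (_ , min) walk =
    walk , λ w → subst (_ ≤_) (len-Walk-map B⊆A w) (min (Walk-map B⊆A w))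

  IsParentMap : (Fin n → ℕ) → (Fin n → Fin n) → Set
  IsParentMap dist p = ∀ a k → dist a ≡ suc k → A (p a) a ≡ true × dist (p a) ≡ k

  parentMap-exists : ∀ {v} {dist : Fin n → ℕ} → (∀ a → IsDist A v a (dist a)) →
                     Σ (Fin n → Fin n) (IsParentMap dist)
  parentMap-exists {v} {dist} dist-isDist = (λ a → proj₁ (parentOf a)) , (λ a → proj₂ (parentOf a))
    where
    parentOf : ∀ a → ∃[ c ] (∀ k → dist a ≡ suc k → A c a ≡ true × dist c ≡ k)
    parentOf a with dist a in da
    ... | zero  = a , λ _ ()
    ... | suc k with IsDist-lastStep (subst (IsDist A v a) da (dist-isDist a))
    ...   | c , e , dc = c , λ { _ refl → e , IsDist-unique (dist-isDist c) dc }

  redirect-isParentMap : ∀ {dist p u w} → IsParentMap dist p → A u w ≡ true → dist w ≡ suc (dist u) →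
                         IsParentMap dist (updateAt p w (const u))
  redirect-isParentMap {p = p} {u} {w} isParentMap uw dw a k da with a ≟ᶠ w
  ... | yes refl rewrite updateAt-updates a {const u} p = uw , suc-injective (trans (sym dw) da)
  ... | no a≢w   rewrite updateAt-minimal a w {const u} p a≢w = isParentMap a k da

module ParentTree {n : ℕ} (G : Graph n) (v : Fin n) (dist : Fin n → ℕ)
  (dist-isDist : ∀ a → IsDist (adj G) v a (dist a))
  (p : Fin n → Fin n) (p-isParentMap : IsParentMap {A = adj G} dist p) where

  IsParentOf : Fin n → Fin n → Set
  IsParentOf a c = p c ≡ a × dist c ≡ suc (dist a)

  TreeEdge : Fin n → Fin n → Set
  TreeEdge a b = IsParentOf a b ⊎ IsParentOf b a

  isParentOf? : ∀ a c → Dec (IsParentOf a c)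
  isParentOf? a c = (p c ≟ᶠ a) ×-dec (dist c ≟ suc (dist a))

  treeAdj : Adjacency n
  treeAdj a b = ⌊ isParentOf? a b ⌋ ∨ ⌊ isParentOf? b a ⌋

  treeAdj-sym : ∀ a b → treeAdj a b ≡ treeAdj b a
  treeAdj-sym a b = ∨-comm ⌊ isParentOf? a b ⌋ ⌊ isParentOf? b a ⌋

  treeAdj⇒TreeEdge : ∀ {a b} → treeAdj a b ≡ true → TreeEdge a b
  treeAdj⇒TreeEdge {a} {b} e =
    ⊎-map (toWitness {a? = isParentOf? a b}) (toWitness {a? = isParentOf? b a})
          (Equivalence.to (T-∨ {⌊ isParentOf? a b ⌋}) (Equivalence.from T-≡ e))

  TreeEdge⇒treeAdj : ∀ {a b} → TreeEdge a b → treeAdj a b ≡ true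
  TreeEdge⇒treeAdj {a} {b} e =
    Equivalence.to T-≡ (Equivalence.from (T-∨ {⌊ isParentOf? a b ⌋})
                          (⊎-map (fromWitness {a? = isParentOf? a b}) (fromWitness {a? = isParentOf? b a}) e))

  IsParentOf-< : ∀ {a c} → IsParentOf a c → dist a < dist c
  IsParentOf-< (_ , dc) = ≤-reflexive (sym dc)

  IsParentOf⇒adj : ∀ {a c} → IsParentOf a c → adj G a c ≡ true
  IsParentOf⇒adj (refl , dc) = proj₁ (p-isParentMap _ _ dc)

  treeAdj⊆adj : ∀ a b → treeAdj a b ≡ true → adj G a b ≡ true
  treeAdj⊆adj a b e with treeAdj⇒TreeEdge e
  ... | inj₁ a↑b = IsParentOf⇒adj a↑b
  ... | inj₂ b↑a = trans (adj-sym G a b) (IsParentOf⇒adj b↑a)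

  fromRoot : ∀ k a → dist a ≡ k → Σ (Walk treeAdj v a) λ w → len w ≡ k
  fromRoot zero a da with IsDist-zero (subst (IsDist (adj G) v a) da (dist-isDist a))
  ... | refl = nil , refl
  fromRoot (suc k) a da with p-isParentMap a k da
  ... | _ , dpa with fromRoot k (p a) dpa
  ...   | w , l = snoc w pa–a , trans (len-snoc w pa–a) (cong suc l)
    where
    pa–a : treeAdj (p a) a ≡ true
    pa–a = TreeEdge⇒treeAdj (inj₁ (refl , trans da (cong suc (sym dpa))))

  treeAdj-isDist : ∀ a → IsDist treeAdj v a (dist a)
  treeAdj-isDist a = IsDist-subgraph treeAdj⊆adj (dist-isDist a) (fromRoot _ a refl)

  data InSubtree (a : Fin n) : Fin n → Set where
    here  : InSubtree a a
    below : ∀ {b c} → IsParentOf b c → InSubtree a b → InSubtree a c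

  InSubtree-dist : ∀ {a c} → InSubtree a c → dist a ≤ dist c
  InSubtree-dist here          = ≤-refl
  InSubtree-dist (below b↑c s) = ≤-trans (InSubtree-dist s) (≤-trans (n≤1+n _) (IsParentOf-< b↑c))

  InSubtree-same-dist : ∀ {x y b} → InSubtree x b → InSubtree y b → dist x ≡ dist y → x ≡ y
  InSubtree-same-dist here here _ = refl
  InSubtree-same-dist here (below c↑b s) eq =
    ⊥-elim (<-irrefl (sym eq) (≤-<-trans (InSubtree-dist s) (IsParentOf-< c↑b)))
  InSubtree-same-dist (below c↑b s) here eq =
    ⊥-elim (<-irrefl eq (≤-<-trans (InSubtree-dist s) (IsParentOf-< c↑b)))
  InSubtree-same-dist (below (refl , _) s) (below (refl , _) s′) eq = InSubtree-same-dist s s′ eq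

  InSubtree-parent : ∀ {a b c} → a ≢ c → IsParentOf b c → InSubtree a c → InSubtree a b
  InSubtree-parent a≢c _          here                 = ⊥-elim (a≢c refl)
  InSubtree-parent _   (refl , _) (below (refl , _) s) = s

  InSubtree-edge : ∀ {a b c} → a ≢ b → a ≢ c → TreeEdge b c → InSubtree a b ⇔ InSubtree a c
  InSubtree-edge a≢b a≢c (inj₁ b↑c) = mk⇔ (below b↑c) (InSubtree-parent a≢c b↑c)
  InSubtree-edge a≢b a≢c (inj₂ c↑b) = mk⇔ (InSubtree-parent a≢b c↑b) (below c↑b)

  InSubtree-walk : ∀ {a b c} (w : Walk treeAdj b c) → All (a ≢_) (verts w) → InSubtree a b ⇔ InSubtree a c
  InSubtree-walk nil        _              = ⇔-id _
  InSubtree-walk (cons e w) (a≢b ∷ avoids) =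
    InSubtree-walk w avoids ⇔-∘ InSubtree-edge a≢b (All-verts-head w avoids) (treeAdj⇒TreeEdge e)

  path-from-child : ∀ {a x b} → IsParentOf a x → (P : Walk treeAdj x b) → IsPath P →
                    All (a ≢_) (verts P) → InSubtree x b
  path-from-child a↑x nil _ _ = here
  path-from-child a↑x (cons e P) (x∉P ∷ _) (_ ∷ a∉P) with treeAdj⇒TreeEdge e
  ... | inj₁ x↑y = Equivalence.to (InSubtree-walk P x∉P) (below x↑y here)
  ... | inj₂ y↑x = ⊥-elim (All-verts-head P a∉P (trans (sym (proj₁ a↑x)) (proj₁ y↑x)))

  no-path-down-and-up : ∀ {a x y b} → IsParentOf a x → IsParentOf y a →
                        (P : Walk treeAdj x b) → All (a ≢_) (verts P) →
                        (Q : Walk treeAdj y b) → All (a ≢_) (verts Q) → ⊥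
  no-path-down-and-up a↑x y↑a P a∉P Q a∉Q =
    n≮n _ (≤-<-trans (InSubtree-dist a-above-y) (IsParentOf-< y↑a))
    where
    a-above-y : InSubtree _ _
    a-above-y = Equivalence.from (InSubtree-walk Q a∉Q)
                  (Equivalence.to (InSubtree-walk P a∉P) (below a↑x here))

  next-vertex-unique : ∀ {a x y b} → treeAdj a x ≡ true → treeAdj a y ≡ true →
                       (P : Walk treeAdj x b) → IsPath P → All (a ≢_) (verts P) →
                       (Q : Walk treeAdj y b) → IsPath Q → All (a ≢_) (verts Q) → x ≡ y
  next-vertex-unique ax ay P P-path a∉P Q Q-path a∉Q with treeAdj⇒TreeEdge ax | treeAdj⇒TreeEdge ay
  ... | inj₁ a↑x | inj₁ a↑y = InSubtree-same-dist (path-from-child a↑x P P-path a∉P)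
                                                   (path-from-child a↑y Q Q-path a∉Q)
                                                   (trans (proj₂ a↑x) (sym (proj₂ a↑y)))
  ... | inj₂ x↑a | inj₂ y↑a = trans (sym (proj₁ x↑a)) (proj₁ y↑a)
  ... | inj₁ a↑x | inj₂ y↑a = ⊥-elim (no-path-down-and-up a↑x y↑a P a∉P Q a∉Q)
  ... | inj₂ x↑a | inj₁ a↑y = ⊥-elim (no-path-down-and-up a↑y x↑a Q a∉Q P a∉P)

  paths-unique : ∀ a b (P Q : Walk treeAdj a b) → IsPath P → IsPath Q → verts P ≡ verts Q
  paths-unique a b nil        nil        _ _ = refl
  paths-unique a b nil        (cons e Q) _ (a∉Q ∷ _) = ⊥-elim (All-verts-last Q a∉Q refl)
  paths-unique a b (cons e P) nil        (a∉P ∷ _) _ = ⊥-elim (All-verts-last P a∉P refl)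
  paths-unique a b (cons {b = x} e P) (cons f Q) (a∉P ∷ P-path) (a∉Q ∷ Q-path)
    with next-vertex-unique e f P P-path a∉P Q Q-path a∉Q
  ... | refl = cong (a ∷_) (paths-unique x b P Q P-path Q-path)

  tree : SpanningTree G
  tree = record
    { tadj     = treeAdj
    ; tadj-sym = treeAdj-sym
    ; tadj-sub = treeAdj⊆adj
    ; is-tree  = (λ a b → reverse treeAdj-sym (proj₁ (fromRoot _ a refl)) ++ʷ proj₁ (fromRoot _ b refl))
               , paths-unique
    }

  tree-isShortestPathTree : IsShortestPathTree G tree v
  tree-isShortestPathTree a k da = subst (IsDist treeAdj v a) (IsDist-unique (dist-isDist a) da) (treeAdj-isDist a)

  IsParentOf⇒IsChild : ∀ {a c} → IsParentOf a c → IsChild tree v a c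
  IsParentOf⇒IsChild {a} {c} a↑c =
    TreeEdge⇒treeAdj (inj₁ a↑c) , dist a , treeAdj-isDist a , subst (IsDist treeAdj v c) (proj₂ a↑c) (treeAdj-isDist c)

module _ {n : ℕ} (G : Graph n) (conn : Connected (adj G)) where

  adj? : ∀ a b → Dec (adj G a b ≡ true)
  adj? a b = adj G a b ≟ᵇ true

  IsShortestPathTree⇒IsDist : ∀ {v} (T : SpanningTree G) → IsShortestPathTree G T v →
                              ∀ {a k} → IsDist (tadj T) v a k → IsDist (adj G) v a k
  IsShortestPathTree⇒IsDist {v} T spt {a} dT with IsDist-exists adj? conn v a
  ... | k , dG = subst (IsDist (adj G) v a) (IsDist-unique (spt a k dG) dT) dG

  child-in-shortestPathTree : ∀ {u w v k} → adj G u w ≡ true → IsDist (adj G) v u k → IsDist (adj G) v w (suc k) →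
                              Σ (SpanningTree G) λ T → IsShortestPathTree G T v × IsChild T v u w
  child-in-shortestPathTree {u} {w} {v} uw du dw =
    tree , tree-isShortestPathTree , IsParentOf⇒IsChild (updateAt-updates w p₀ , dw′)
    where
    dist : Fin n → ℕ
    dist a = proj₁ (IsDist-exists adj? conn v a)

    dist-isDist : ∀ a → IsDist (adj G) v a (dist a)
    dist-isDist a = proj₂ (IsDist-exists adj? conn v a)

    dw′ : dist w ≡ suc (dist u)
    dw′ = trans (IsDist-unique (dist-isDist w) dw) (cong suc (IsDist-unique du (dist-isDist u)))

    p₀ : Fin n → Fin n
    p₀ = proj₁ (parentMap-exists dist-isDist)

    open ParentTree G v dist dist-isDist (updateAt p₀ w (const u))
      (redirect-isParentMap {A = adj G} (proj₂ (parentMap-exists dist-isDist)) uw dw′)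

  far⇒leaf : ∀ u v → IsFar G v u → ∀ T → IsShortestPathTree G T v → IsLeaf T v u
  far⇒leaf u v far T spt y (uy , k , du , dy) =
    n≮n k (far y (tadj-sub T u y uy) (suc k) k (IsShortestPathTree⇒IsDist T spt dy) (IsShortestPathTree⇒IsDist T spt du))

  leaf⇒far : ∀ u v → (∀ T → IsShortestPathTree G T v → IsLeaf T v u) → IsFar G v u
  leaf⇒far u v leaf w uw kw ku dw du with kw ≤? ku
  ... | yes kw≤ku = kw≤ku
  ... | no kw≰ku with child-in-shortestPathTree uw du
                        (subst (IsDist (adj G) v w) (≤-antisym (IsDist-edge du dw uw) (≰⇒> kw≰ku)) dw)
  ...   | T , spt , u→w = ⊥-elim (leaf T spt w u→w)

lemma1 : ∀ {n} (G : Graph n) → Connected (adj G) → (u v : Fin n) →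
    IsFar G v u ⇔ (∀ (T : SpanningTree G) → IsShortestPathTree G T v → IsLeaf T v u)
lemma1 G conn u v = mk⇔ (far⇒leaf G conn u v) (leaf⇒far G conn u v)
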